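{- Let $m$ be a string transduction. Then $m\in\mathrm{NGSM}_{fin}$ if and only if $m\in\mathrm{NGSM}$ and $m$ is finitary.
   Context: A relation $R$ is finitary if $\{z\mid(w,z)\in R\}$ is finite for each $w$ in its domain. 2gsm: $M=(Q,\Sigma_1,\Sigma_2,\delta,q_{in},q_f)$ with finite $Q$ and instructions $(p,\sigma,q_1,\alpha_1,\epsilon_1,q_0,\alpha_0,\epsilon_0)$, $p\ne q_f$, $\sigma\in\Sigma_1\cup\{\vdash,\dashv\}$, $\alpha_i\in\Sigma_2^*$, $\epsilon_i\in\{ -1,0,+1\}$; on input $w$ the read-only tape holds $\vdash w\dashv$; in state $p$ scanning $\tau$ any instruction starting with $p$ may be executed: enter $q_1$, output $\alpha_1$, move by $\epsilon_1$ if $\tau=\sigma$, otherwise use $(q_0,\alpha_0,\epsilon_0)$; $(w,z)$ is realized iff some computation from $q_{in}$ at position $0$ reaches $q_f$ with output $z$. $\mathrm{NGSM}$: transductions realized by 2gsm's. A computation is $k$-visiting if each tape position is visited at most $k$ times; $M$ is finite visit if there is $k$ such that every realized pair $(w,z)$ has a $k$-visiting computation; $\mathrm{NGSM}_{fin}$: transductions realized by finite visit 2gsm's. -}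

module Defs where

open import Data.Nat using (ℕ; zero; suc; _≤_)
open import Data.Fin using (Fin)
open import Data.List using (List; []; _∷_; _++_; length)
open import Data.List.Membership.Propositional using (_∈_)
open import Data.List.Relation.Unary.All using (All)
open import Data.Product using (Σ; ∃; _×_; _,_)
open import Relation.Binary.PropositionalEquality using (_≡_; _≢_)
open import Function.Bundles using (_⇔_)
import Data.Nat
import Relation.Nullary

Transduction : ℕ → ℕ → Set₁
Transduction a b = List (Fin a) → List (Fin b) → Set

data TapeSym (a : ℕ) : Set where
  ⊢ : TapeSym a
  ⊣ : TapeSym a
  sym : Fin a → TapeSym a

data Dir : Set where
  left stay right : Dir

-- symbol at position i of the tape ⊢ w ⊣ (positions 0 .. |w|+1)
tapeAt : {a : ℕ} → List (Fin a) → ℕ → TapeSym a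
tapeAt w zero = ⊢
tapeAt [] (suc _) = ⊣
tapeAt (x ∷ w) (suc zero) = sym x
tapeAt (x ∷ w) (suc (suc i)) = tapeAt w (suc i)

data Moves : Dir → ℕ → ℕ → Set where
  mvL : ∀ {i} → Moves left (suc i) i
  mvS : ∀ {i} → Moves stay i i
  mvR : ∀ {i} → Moves right i (suc i)

record Instr (nq a b : ℕ) : Set where
  constructor instr
  field
    p  : Fin nq
    σ  : TapeSym a
    q₁ : Fin nq
    α₁ : List (Fin b)
    ε₁ : Dir
    q₀ : Fin nq
    α₀ : List (Fin b)
    ε₀ : Dir

record TwoGSM (a b : ℕ) : Set where
  field
    nq   : ℕ
    δ    : List (Instr nq a b)
    qin  : Fin nq
    qf   : Fin nq
    δ-ok : All (λ ι → Instr.p ι ≢ qf) δ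

module _ {a b : ℕ} (M : TwoGSM a b) (w : List (Fin a)) where
  open TwoGSM M

  -- Comp (q , i) (q' , i') vs z : a computation from configuration (q , i)
  -- to (q' , i'); vs lists the positions of all configurations visited
  -- (in order, including first and last), z is the produced output.
  data Comp : Fin nq × ℕ → Fin nq × ℕ → List ℕ → List (Fin b) → Set where
    stop  : ∀ {q i} → Comp (q , i) (q , i) (i ∷ []) []
    step₁ : ∀ {i j c vs z} (ι : Instr nq a b) → ι ∈ δ →
            tapeAt w i ≡ Instr.σ ι →
            Moves (Instr.ε₁ ι) i j → j ≤ suc (length w) →
            Comp (Instr.q₁ ι , j) c vs z →
            Comp (Instr.p ι , i) c (i ∷ vs) (Instr.α₁ ι ++ z)
    step₀ : ∀ {i j c vs z} (ι : Instr nq a b) → ι ∈ δ →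
            tapeAt w i ≢ Instr.σ ι →
            Moves (Instr.ε₀ ι) i j → j ≤ suc (length w) →
            Comp (Instr.q₀ ι , j) c vs z →
            Comp (Instr.p ι , i) c (i ∷ vs) (Instr.α₀ ι ++ z)

  AccComp : List ℕ → List (Fin b) → Set
  AccComp vs z = ∃ λ i → Comp (qin , 0) (qf , i) vs z

occ : ℕ → List ℕ → ℕ
occ j [] = 0
occ j (x ∷ xs) with Data.Nat._≟_ j x
... | Relation.Nullary.yes _ = suc (occ j xs)
... | Relation.Nullary.no _ = occ j xs

KVisiting : ℕ → List ℕ → Set
KVisiting k vs = ∀ j → occ j vs ≤ k

Realizes : {a b : ℕ} → TwoGSM a b → List (Fin a) → List (Fin b) → Set
Realizes M w z = ∃ λ vs → AccComp M w vs z

FiniteVisit : {a b : ℕ} → TwoGSM a b → Set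
FiniteVisit M = ∃ λ k → ∀ w z → Realizes M w z →
  ∃ λ vs → AccComp M w vs z × KVisiting k vs

RealizedBy : {a b : ℕ} → Transduction a b → TwoGSM a b → Set
RealizedBy m M = ∀ w z → m w z ⇔ Realizes M w z

InNGSM : {a b : ℕ} → Transduction a b → Set
InNGSM m = Σ (TwoGSM _ _) λ M → RealizedBy m M

InNGSMfin : {a b : ℕ} → Transduction a b → Set
InNGSMfin m = Σ (TwoGSM _ _) λ M → FiniteVisit M × RealizedBy m M

Finitary : {a b : ℕ} → Transduction a b → Set
Finitary m = ∀ w → (∃ λ z → m w z) → ∃ λ (zs : List _) → ∀ z → m w z → z ∈ zs

-- A run of a 2gsm in which some configuration (state, head position) repeats
-- contains a loop.  If the loop produces no output it can be cut out; if it
-- does, iterating it yields outputs of unbounded length for the same input,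
-- which a finitary transduction forbids.  So for finitary m every realized pair
-- has a run without repeated configurations, and such a run visits each
-- position at most once per state.  Conversely, a k-visiting run on w has at
-- most (|w| + 2) k steps, so its output is one of finitely many concatenations
-- of instruction outputs.
module Submission where

open import Defs hiding (sym)
open import Data.Nat using (ℕ; zero; suc; _+_; _*_; _≤_; _<_; z≤n; s≤s; _≤′_; ≤′-refl; ≤′-step)
open import Data.Nat.Properties
  using (_≟_; ≤-refl; ≤-trans; ≤-pred; n≤1+n; m≤m+n; m≤n+m; ≤∧≢⇒<; <⇒≱; ≤⇒≤′;
         +-mono-≤; +-mono-<-≤; +-mono-≤-<)
open import Data.Nat.ListAction using (sum)
open import Data.Fin as Fin using (Fin)
open import Data.Fin.Properties using (injective⇒≤)
open import Data.List
  using (List; []; _∷_; _++_; [_]; length; map; filter; concatMap; cartesianProductWith; lookup)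
open import Data.List.Properties using (++-assoc; length-++; filter-accept; filter-reject)
open import Data.List.Membership.Propositional using (_∈_)
open import Data.List.Membership.Propositional.Properties
  using (∈-++⁺ˡ; ∈-++⁺ʳ; ∈-cartesianProductWith⁺; ∈-concatMap⁺; ∈-map⁺; ∈-lookup; ∈-filter⁻)
open import Data.List.Relation.Unary.Any as Any using (here; there)
open import Data.List.Relation.Unary.All as All using (All; []; _∷_)
open import Data.List.Relation.Unary.All.Properties using (¬Any⇒All¬)
open import Data.List.Relation.Unary.Unique.Propositional using (Unique; []; _∷_)
open import Data.List.Relation.Unary.Unique.Propositional.Properties using (filter⁺)
open import Data.Product using (∃; _×_; _,_; proj₁; proj₂)
open import Data.Product.Properties using (≡-dec)
open import Data.Sum using (_⊎_; inj₁; inj₂)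
open import Data.Empty using (⊥-elim)
open import Function.Bundles using (module Equivalence)
open import Relation.Nullary using (Dec; yes; no; ¬_)
open import Relation.Binary.PropositionalEquality
  using (_≡_; _≢_; refl; sym; trans; cong; subst; module ≡-Reasoning)
open Equivalence using (to; from)

sumBelow : ℕ → (ℕ → ℕ) → ℕ
sumBelow zero    f = 0
sumBelow (suc n) f = f n + sumBelow n f

sumBelow-mono-≤ : ∀ n {f g : ℕ → ℕ} → (∀ j → f j ≤ g j) → sumBelow n f ≤ sumBelow n g
sumBelow-mono-≤ zero    f≤g = z≤n
sumBelow-mono-≤ (suc n) f≤g = +-mono-≤ (f≤g n) (sumBelow-mono-≤ n f≤g)

sumBelow-≤-* : ∀ n {f : ℕ → ℕ} {k} → (∀ j → f j ≤ k) → sumBelow n f ≤ n * k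
sumBelow-≤-* zero    f≤k = z≤n
sumBelow-≤-* (suc n) f≤k = +-mono-≤ (f≤k n) (sumBelow-≤-* n f≤k)

sumBelow-mono-< : ∀ n {f g : ℕ → ℕ} {x} → x < n →
                  (∀ j → f j ≤ g j) → f x < g x → sumBelow n f < sumBelow n g
sumBelow-mono-< (suc n) {x = x} x<1+n f≤g fx<gx with x ≟ n
... | yes refl = +-mono-<-≤ fx<gx (sumBelow-mono-≤ n f≤g)
... | no x≢n   = +-mono-≤-< (f≤g n) (sumBelow-mono-< n (≤∧≢⇒< (≤-pred x<1+n) x≢n) f≤g fx<gx)

occ-≤-∷ : ∀ j x xs → occ j xs ≤ occ j (x ∷ xs)
occ-≤-∷ j x xs with j ≟ x
... | yes _ = n≤1+n _
... | no _  = ≤-refl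

occ-<-∷ : ∀ x xs → occ x xs < occ x (x ∷ xs)
occ-<-∷ x xs with x ≟ x
... | yes _  = ≤-refl
... | no x≢x = ⊥-elim (x≢x refl)

length≤sumBelow-occ : ∀ n {xs} → All (_< n) xs → length xs ≤ sumBelow n (λ j → occ j xs)
length≤sumBelow-occ n []                   = z≤n
length≤sumBelow-occ n {x ∷ xs} (x<n ∷ xs<n) = ≤-trans (s≤s (length≤sumBelow-occ n xs<n))
  (sumBelow-mono-< n x<n (λ j → occ-≤-∷ j x xs) (occ-<-∷ x xs))

kVisiting⇒length≤ : ∀ {n k xs} → All (_< n) xs → KVisiting k xs → length xs ≤ n * k
kVisiting⇒length≤ {n} xs<n kv = ≤-trans (length≤sumBelow-occ n xs<n) (sumBelow-≤-* n kv)

module _ {A : Set} where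

  lookup-injective : ∀ {xs : List A} → Unique xs → ∀ {i j} → lookup xs i ≡ lookup xs j → i ≡ j
  lookup-injective (x≢xs ∷ u) {Fin.zero}  {Fin.zero}  _ = refl
  lookup-injective (x≢xs ∷ u) {Fin.zero}  {Fin.suc j} e = ⊥-elim (All.lookup x≢xs (∈-lookup j) e)
  lookup-injective (x≢xs ∷ u) {Fin.suc i} {Fin.zero}  e = ⊥-elim (All.lookup x≢xs (∈-lookup i) (sym e))
  lookup-injective (x≢xs ∷ u) {Fin.suc i} {Fin.suc j} e = cong Fin.suc (lookup-injective u e)

  unique⇒length≤ : ∀ {n xs} (f : A → Fin n) → Unique xs →
                   (∀ {x y} → x ∈ xs → y ∈ xs → f x ≡ f y → x ≡ y) → length xs ≤ n
  unique⇒length≤ f u f-inj = injective⇒≤ λ e → lookup-injective u (f-inj (∈-lookup _) (∈-lookup _) e)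

module _ {A : Set} (ws : List (List A)) where

  concatenations : ℕ → List (List A)
  concatenations zero    = [ [] ]
  concatenations (suc n) = concatenations n ++ cartesianProductWith _++_ ws (concatenations n)

  concatenations-mono : ∀ {m n z} → m ≤′ n → z ∈ concatenations m → z ∈ concatenations n
  concatenations-mono ≤′-refl        z∈ = z∈
  concatenations-mono (≤′-step m≤′n) z∈ = ∈-++⁺ˡ (concatenations-mono m≤′n z∈)

  ∈-concatenations-++ : ∀ {n α z} → α ∈ ws → z ∈ concatenations n → α ++ z ∈ concatenations (suc n)
  ∈-concatenations-++ {n} α∈ z∈ = ∈-++⁺ʳ (concatenations n) (∈-cartesianProductWith⁺ _++_ α∈ z∈)

module Runs {a b : ℕ} (M : TwoGSM a b) (w : List (Fin a)) where
  open TwoGSM M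
  open Instr

  outputsOf : Instr nq a b → List (List (Fin b))
  outputsOf ι = α₁ ι ∷ α₀ ι ∷ []

  instrOutputs : List (List (Fin b))
  instrOutputs = concatMap outputsOf δ

  ∈-instrOutputs : ∀ {ι α} → ι ∈ δ → α ∈ outputsOf ι → α ∈ instrOutputs
  ∈-instrOutputs ι∈δ α∈ = ∈-concatMap⁺ outputsOf (Any.map (λ { refl → α∈ }) ι∈δ)

  output∈concatenations : ∀ {s c vs z} → Comp M w s c vs z →
                          z ∈ concatenations instrOutputs (length vs)
  output∈concatenations stop = here refl
  output∈concatenations (step₁ {vs = vs} ι ι∈δ _ _ _ r) =
    ∈-concatenations-++ instrOutputs {length vs}
      (∈-instrOutputs ι∈δ (here refl)) (output∈concatenations r)
  output∈concatenations (step₀ {vs = vs} ι ι∈δ _ _ _ r) =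
    ∈-concatenations-++ instrOutputs {length vs}
      (∈-instrOutputs ι∈δ (there (here refl))) (output∈concatenations r)

  visits-onTape : ∀ {q i c vs z} → Comp M w (q , i) c vs z → i ≤ suc (length w) →
                  All (_< suc (suc (length w))) vs
  visits-onTape stop                   i≤ = s≤s i≤ ∷ []
  visits-onTape (step₁ _ _ _ _ j≤ r) i≤ = s≤s i≤ ∷ visits-onTape r j≤
  visits-onTape (step₀ _ _ _ _ j≤ r) i≤ = s≤s i≤ ∷ visits-onTape r j≤

  Conf : Set
  Conf = Fin nq × ℕ

  data Step : Conf → Conf → List (Fin b) → Set where
    step₁ : ∀ {i j} (ι : Instr nq a b) → ι ∈ δ → tapeAt w i ≡ σ ι →
            Moves (ε₁ ι) i j → j ≤ suc (length w) → Step (p ι , i) (q₁ ι , j) (α₁ ι)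
    step₀ : ∀ {i j} (ι : Instr nq a b) → ι ∈ δ → tapeAt w i ≢ σ ι →
            Moves (ε₀ ι) i j → j ≤ suc (length w) → Step (p ι , i) (q₀ ι , j) (α₀ ι)

  infixr 5 _◅_

  -- Comp only records head positions; a Path records whole configurations,
  -- which is what detecting a loop requires.

  data Path : Conf → Conf → List Conf → List (Fin b) → Set where
    ε   : ∀ {s} → Path s s [ s ] []
    _◅_ : ∀ {s t c α cs z} → Step s t α → Path t c cs z → Path s c (s ∷ cs) (α ++ z)

  Reach : Conf → Conf → List (Fin b) → Set
  Reach s c z = ∃ λ cs → Path s c cs z

  comp⇒path : ∀ {s c vs z} → Comp M w s c vs z → Reach s c z
  comp⇒path stop = _ , ε
  comp⇒path (step₁ ι ι∈δ eq mv j≤ r) = _ , step₁ ι ι∈δ eq mv j≤ ◅ proj₂ (comp⇒path r)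
  comp⇒path (step₀ ι ι∈δ eq mv j≤ r) = _ , step₀ ι ι∈δ eq mv j≤ ◅ proj₂ (comp⇒path r)

  path⇒comp : ∀ {s c cs z} → Path s c cs z → Comp M w s c (map proj₂ cs) z
  path⇒comp ε = stop
  path⇒comp (step₁ ι ι∈δ eq mv j≤ ◅ r) = step₁ ι ι∈δ eq mv j≤ (path⇒comp r)
  path⇒comp (step₀ ι ι∈δ eq mv j≤ ◅ r) = step₀ ι ι∈δ eq mv j≤ (path⇒comp r)

  _◅◅_ : ∀ {s t c cs ds z₁ z₂} → Path s t cs z₁ → Path t c ds z₂ → Reach s c (z₁ ++ z₂)
  ε ◅◅ r = _ , r
  _◅◅_ {z₂ = z₂} (_◅_ {α = α} {z = z} st p) r =
    subst (Reach _ _) (sym (++-assoc α z z₂)) (_ , st ◅ proj₂ (p ◅◅ r))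

  Pumpable : Conf → Conf → Set
  Pumpable s c = ∀ N → ∃ λ z → N ≤ length z × Reach s c z

  loop⇒pumpable : ∀ {s cs α} → Path s s cs α → 0 < length α → Pumpable s s
  loop⇒pumpable p 0<|α| zero    = [] , z≤n , _ , ε
  loop⇒pumpable {α = α} p 0<|α| (suc N) with loop⇒pumpable p 0<|α| N
  ... | z , N≤|z| , _ , r = α ++ z , 1+N≤|α++z| , p ◅◅ r
    where
    1+N≤|α++z| : suc N ≤ length (α ++ z)
    1+N≤|α++z| = subst (suc N ≤_) (sym (length-++ α)) (+-mono-≤ 0<|α| N≤|z|)

  pumpable-◅◅ : ∀ {s t c ds z} → Pumpable s t → Path t c ds z → Pumpable s c
  pumpable-◅◅ {z = z} pump r N with pump N
  ... | z′ , N≤|z′| , _ , p = z′ ++ z , N≤|z′++z| , p ◅◅ r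
    where
    N≤|z′++z| : N ≤ length (z′ ++ z)
    N≤|z′++z| = subst (N ≤_) (sym (length-++ z′)) (≤-trans N≤|z′| (m≤m+n _ _))

  ◅-pumpable : ∀ {s t c α} → Step s t α → Pumpable t c → Pumpable s c
  ◅-pumpable {α = α} st pump N with pump N
  ... | z , N≤|z| , _ , r = α ++ z , N≤|α++z| , _ , st ◅ r
    where
    N≤|α++z| : N ≤ length (α ++ z)
    N≤|α++z| = subst (N ≤_) (sym (length-++ α)) (≤-trans N≤|z| (m≤n+m _ _))

  record SplitAt (s′ s c : Conf) (z : List (Fin b)) : Set where
    constructor splitting
    field
      before after    : List (Fin b)
      z≡before++after : z ≡ before ++ after
      toS             : Reach s′ s before
      rest            : List Conf
      fromS           : Path s c rest after
      rest-unique     : Unique rest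

  splitAt : ∀ {s′ s c cs z} → Path s′ c cs z → s ∈ cs → Unique cs → SplitAt s′ s c z
  splitAt p@ε       (here refl) u = splitting [] _ refl (_ , ε) _ p u
  splitAt p@(_ ◅ _) (here refl) u = splitting [] _ refl (_ , ε) _ p u
  splitAt (_◅_ {α = α} st p) (there s∈cs) (_ ∷ u) with splitAt p s∈cs u
  ... | splitting before after z≡ (_ , toS) rest fromS rest-unique =
    splitting (α ++ before) after (trans (cong (α ++_) z≡) (sym (++-assoc α before after)))
              (_ , st ◅ toS) rest fromS rest-unique

  LoopFree : Conf → Conf → List (Fin b) → Set
  LoopFree s c z = ∃ λ cs → Path s c cs z × Unique cs

  open import Data.List.Membership.DecPropositional (≡-dec (Fin._≟_ {nq}) _≟_) using (_∈?_)

  ◅-loopFree : ∀ {s t c α z} → Step s t α → LoopFree t c z →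
               LoopFree s c (α ++ z) ⊎ Pumpable s c
  ◅-loopFree {s} {t} {c} {α} {z} st (cs , p , u) with s ∈? cs
  ... | no s∉cs  = inj₁ (_ , st ◅ p , ¬Any⇒All¬ cs s∉cs ∷ u)
  ... | yes s∈cs = cutLoop (splitAt p s∈cs u)
    where
    cutLoop : SplitAt t s c z → LoopFree s c (α ++ z) ⊎ Pumpable s c
    cutLoop (splitting before after z≡ (_ , toS) _ fromS rest-unique) = byLoopOutput _ refl
      where
      byLoopOutput : ∀ ℓ → α ++ before ≡ ℓ → LoopFree s c (α ++ z) ⊎ Pumpable s c
      byLoopOutput []      loop = inj₁ (_ , subst (Path s c _) after≡α++z fromS , rest-unique)
        where
        open ≡-Reasoning
        after≡α++z : after ≡ α ++ z
        after≡α++z = sym (begin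
          α ++ z                 ≡⟨ cong (α ++_) z≡ ⟩
          α ++ before ++ after   ≡⟨ ++-assoc α before after ⟨
          (α ++ before) ++ after ≡⟨ cong (_++ after) loop ⟩
          after                  ∎)
      byLoopOutput (_ ∷ _) loop = inj₂ (pumpable-◅◅ (loop⇒pumpable (st ◅ toS) 0<|loop|) fromS)
        where
        0<|loop| : 0 < length (α ++ before)
        0<|loop| = subst (λ ℓ → 0 < length ℓ) (sym loop) (s≤s z≤n)

  loopFree⊎pumpable : ∀ {s c cs z} → Path s c cs z → LoopFree s c z ⊎ Pumpable s c
  loopFree⊎pumpable ε = inj₁ (_ , ε , [] ∷ [])
  loopFree⊎pumpable (st ◅ p) with loopFree⊎pumpable p
  ... | inj₁ loopFree = ◅-loopFree st loopFree
  ... | inj₂ pumpable = inj₂ (◅-pumpable st pumpable)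

  at? : ∀ j (c : Conf) → Dec (j ≡ proj₂ c)
  at? j c = j ≟ proj₂ c

  atPosition : ℕ → List Conf → List Conf
  atPosition j = filter (at? j)

  occ≡length-atPosition : ∀ j cs → occ j (map proj₂ cs) ≡ length (atPosition j cs)
  occ≡length-atPosition j [] = refl
  occ≡length-atPosition j ((q , i) ∷ cs) with j ≟ i
  ... | yes j≡i = trans (cong suc (occ≡length-atPosition j cs))
                        (cong length (sym (filter-accept (at? j) j≡i)))
  ... | no j≢i  = trans (occ≡length-atPosition j cs)
                        (cong length (sym (filter-reject (at? j) j≢i)))

  unique⇒nqVisiting : ∀ {cs} → Unique cs → KVisiting nq (map proj₂ cs)
  unique⇒nqVisiting {cs} u j = subst (_≤ nq) (sym (occ≡length-atPosition j cs))
    (unique⇒length≤ proj₁ (filter⁺ (at? j) u) sameState⇒sameConf)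
    where
    sameState⇒sameConf : ∀ {x y} → x ∈ atPosition j cs → y ∈ atPosition j cs →
                         proj₁ x ≡ proj₁ y → x ≡ y
    sameState⇒sameConf x∈ y∈ refl with ∈-filter⁻ (at? j) {xs = cs} x∈ | ∈-filter⁻ (at? j) {xs = cs} y∈
    ... | _ , refl | _ , refl = refl

  bounded⇒¬pumpable : ∀ {s c B} → (∀ {z} → Reach s c z → length z ≤ B) → ¬ Pumpable s c
  bounded⇒¬pumpable {B = B} bound pumpable with pumpable (suc B)
  ... | z , B<|z| , r = <⇒≱ B<|z| (bound r)

  bounded⇒nqVisiting : ∀ {s c B vs z} → (∀ {z′} → Reach s c z′ → length z′ ≤ B) →
                       Comp M w s c vs z → ∃ λ vs′ → Comp M w s c vs′ z × KVisiting nq vs′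
  bounded⇒nqVisiting bound run with loopFree⊎pumpable (proj₂ (comp⇒path run))
  ... | inj₁ (cs , p , u) = map proj₂ cs , path⇒comp p , unique⇒nqVisiting u
  ... | inj₂ pumpable     = ⊥-elim (bounded⇒¬pumpable bound pumpable)

∈⇒≤sum : ∀ {n ns} → n ∈ ns → n ≤ sum ns
∈⇒≤sum (here refl) = m≤m+n _ _
∈⇒≤sum {ns = n′ ∷ ns} (there n∈ns) = ≤-trans (∈⇒≤sum n∈ns) (m≤n+m _ n′)

finitary⇒outputs-bounded : ∀ {a b} {m : Transduction a b} → Finitary m →
                           ∀ {w z} → m w z → ∃ λ B → ∀ z′ → m w z′ → length z′ ≤ B
finitary⇒outputs-bounded fin {w} {z} mwz with fin w (z , mwz)
... | zs , complete = sum (map length zs) , λ z′ mwz′ → ∈⇒≤sum (∈-map⁺ length (complete z′ mwz′))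

module _ {a b : ℕ} {m : Transduction a b} (M : TwoGSM a b) (realizes : RealizedBy m M) where

  finiteVisit⇒finitary : FiniteVisit M → Finitary m
  finiteVisit⇒finitary (k , kVisitingRun) w _ =
    concatenations instrOutputs (suc (suc (length w)) * k) , λ z mwz →
      let (vs , (_ , run) , kv) = kVisitingRun w z (to (realizes w z) mwz)
      in concatenations-mono instrOutputs (≤⇒≤′ (kVisiting⇒length≤ (visits-onTape run z≤n) kv))
                             (output∈concatenations run)
    where open Runs M w

  finitary⇒finiteVisit : Finitary m → FiniteVisit M
  finitary⇒finiteVisit fin = TwoGSM.nq M , λ w z (vs , i , run) →
    let (B , bound) = finitary⇒outputs-bounded fin (from (realizes w z) (vs , i , run))
        (vs′ , run′ , nqVisiting) = Runs.bounded⇒nqVisiting M w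
          (λ (_ , p) → bound _ (from (realizes w _) (_ , i , Runs.path⇒comp M w p))) run
    in vs′ , (i , run′) , nqVisiting

lemma6p1 : {a b : ℕ} (m : Transduction a b) →
    (InNGSMfin m → InNGSM m × Finitary m) × (InNGSM m × Finitary m → InNGSMfin m)
lemma6p1 m =
  (λ (M , finiteVisit , realizes) → (M , realizes) , finiteVisit⇒finitary M realizes finiteVisit) ,
  (λ ((M , realizes) , finitary) → M , finitary⇒finiteVisit M realizes finitary , realizes)
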